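{- Let $\mathcal{G}$ be a finite, simple, connected undirected graph with vertex set $V$, and let $G$ and $G'$ be facet graphs of $\mathcal{G}$ such that an edge $xy$ of $\mathcal{G}$ is oriented from $x$ to $y$ in $G$ and from $y$ to $x$ in $G'$. Then there is a partition $V=V_0\sqcup V_1$ with $x\in V_0$, $y\in V_1$, such that every edge of $\mathcal{G}$ between $V_0$ and $V_1$ is either not present in $G$ or oriented in $G$ from $V_0$ to $V_1$, and is either not present in $G'$ or oriented in $G'$ from $V_1$ to $V_0$.
   Context: A layering is $l:V\to\mathbb{Z}$ with $|l(u)-l(v)|\le1$ for every edge $uv$ of $\mathcal{G}$ such that the edges $E_l=\{uv:|l(u)-l(v)|=1\}$ form a connected spanning subgraph of $\mathcal{G}$. Its facet graph is the digraph $(V,E_l)$ where $uv$ is oriented from $u$ to $v$ when $l(v)-l(u)=1$. An edge of $\mathcal{G}$ is present in a facet graph if it belongs to its edge set $E_l$. -}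

module Defs where

open import Data.Nat using (ℕ)
open import Data.Fin using (Fin)
open import Data.Integer using (ℤ; _+_; _-_; _≤_; ∣_∣; +_; 1ℤ)
open import Data.Bool using (Bool; true; false)
open import Data.Product using (_×_)
open import Data.Sum using (_⊎_)
open import Relation.Nullary using (¬_; Dec)
open import Relation.Binary.PropositionalEquality using (_≡_)
import Data.Nat as ℕ

record SimpleGraph (n : ℕ) : Set₁ where
  field
    Adj     : Fin n → Fin n → Set
    sym     : ∀ {u v} → Adj u v → Adj v u
    irrefl  : ∀ {u} → ¬ Adj u u
    -- adjacency is a proposition (at most one edge between two vertices)
    adjProp : ∀ {u v} (p q : Adj u v) → p ≡ q
    adjDec  : ∀ u v → Dec (Adj u v)
open SimpleGraph public

data Walk {n : ℕ} (R : Fin n → Fin n → Set) : Fin n → Fin n → Set where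
  nil  : ∀ {u} → Walk R u u
  cons : ∀ {u v w} → R u v → Walk R v w → Walk R u w

Connected : {n : ℕ} → (Fin n → Fin n → Set) → Set
Connected R = ∀ u v → Walk R u v

Eₗ : {n : ℕ} → SimpleGraph n → (Fin n → ℤ) → Fin n → Fin n → Set
Eₗ 𝒢 l u v = Adj 𝒢 u v × ∣ l u - l v ∣ ≡ 1

record IsLayering {n : ℕ} (𝒢 : SimpleGraph n) (l : Fin n → ℤ) : Set where
  field
    lipschitz : ∀ {u v} → Adj 𝒢 u v → ∣ l u - l v ∣ ℕ.≤ 1
    spanning  : Connected (Eₗ 𝒢 l)
open IsLayering public

-- In the facet graph of l, the edge uv is present and oriented from u to v.
Oriented : {n : ℕ} → SimpleGraph n → (Fin n → ℤ) → Fin n → Fin n → Set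
Oriented 𝒢 l u v = Adj 𝒢 u v × l v - l u ≡ 1ℤ

Present : {n : ℕ} → SimpleGraph n → (Fin n → ℤ) → Fin n → Fin n → Set
Present 𝒢 l u v = Eₗ 𝒢 l u v

-- Put d = l′ − l. Along the edge xy the two layerings step in opposite directions, so
-- d drops by 2 from x to y; let V₀ be the vertices where d is at least d(x). On any
-- edge uv of 𝒢 each layering moves by at most one, so if d drops along uv then l
-- cannot go down and l′ cannot go up: in each facet graph uv is absent or points the
-- required way.
module Submission where

open import Defs
open import Data.Nat using (ℕ; suc; s≤s; z≤n)
import Data.Nat as ℕ
open import Data.Nat.Properties using (0≢1+n)
open import Data.Fin using (Fin)
open import Data.Integer using (ℤ; +_; +<+; -[1+_]; _+_; _-_; -_; ∣_∣; _<_; _<?_; 0ℤ; 1ℤ)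
open import Data.Integer.Properties
  using (∣i-j∣≡∣j-i∣; +-comm; <-irrefl; <-≤-trans; ≮⇒≥; +-monoˡ-<; +-inverseʳ; +-identityˡ)
open import Data.Integer.Tactic.RingSolver using (solve-∀)
open import Data.Bool using (Bool; true; false)
open import Data.Product using (Σ; _×_; _,_)
open import Data.Sum using (_⊎_; inj₁; inj₂)
open import Data.Empty using (⊥-elim)
open import Function using (_∘_)
open import Relation.Nullary using (¬_; does; yes; no)
open import Relation.Nullary.Decidable using (dec-true; dec-false)
open import Relation.Binary.PropositionalEquality
  using (_≡_; refl; trans; cong; cong₂; subst; subst₂) renaming (sym to ≡-sym)

private variable
  n : ℕ

i<j⇒0<j-i : ∀ {i j} → i < j → 0ℤ < j - i
i<j⇒0<j-i {i} {j} i<j = subst (_< j - i) (+-inverseʳ i) (+-monoˡ-< (- i) i<j)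

0<j-i⇒i<j : ∀ {i j} → 0ℤ < j - i → i < j
0<j-i⇒i<j {i} {j} 0<j-i = subst₂ _<_ (+-identityˡ i) (minus-plus j i) (+-monoˡ-< i 0<j-i)
  where
  minus-plus : ∀ j i → j - i + i ≡ j
  minus-plus = solve-∀

∣i∣≤1∧∣j∣≤1∧0<i+j⇒i≡0⊎i≡1 :
  ∀ i j → ∣ i ∣ ℕ.≤ 1 → ∣ j ∣ ℕ.≤ 1 → 0ℤ < i + j → i ≡ 0ℤ ⊎ i ≡ 1ℤ
∣i∣≤1∧∣j∣≤1∧0<i+j⇒i≡0⊎i≡1 (+ 0)           _                _        _        _   = inj₁ refl
∣i∣≤1∧∣j∣≤1∧0<i+j⇒i≡0⊎i≡1 (+ 1)           _                _        _        _   = inj₂ refl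
∣i∣≤1∧∣j∣≤1∧0<i+j⇒i≡0⊎i≡1 (+ suc (suc _)) _                (s≤s ()) _        _
∣i∣≤1∧∣j∣≤1∧0<i+j⇒i≡0⊎i≡1 -[1+ suc _ ]    _                (s≤s ()) _        _
∣i∣≤1∧∣j∣≤1∧0<i+j⇒i≡0⊎i≡1 -[1+ 0 ]        (+ 0)            _        _        ()
∣i∣≤1∧∣j∣≤1∧0<i+j⇒i≡0⊎i≡1 -[1+ 0 ]        (+ 1)            _        _        0<0 = ⊥-elim (<-irrefl refl 0<0)
∣i∣≤1∧∣j∣≤1∧0<i+j⇒i≡0⊎i≡1 -[1+ 0 ]        (+ suc (suc _))  _        (s≤s ()) _
∣i∣≤1∧∣j∣≤1∧0<i+j⇒i≡0⊎i≡1 -[1+ 0 ]        -[1+ _ ]         _        _        ()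

-- With a = l u, a′ = l′ u, b = l v, b′ = l′ v: the drop of l′ − l along uv is the step
-- of l along uv plus the step of l′ along vu.
difference-jump : ∀ a a′ b b′ → (a′ - a) - (b′ - b) ≡ (b - a) + (a′ - b′)
difference-jump = solve-∀

module _ (𝒢 : SimpleGraph n) where

  Lipschitz : (Fin n → ℤ) → Set
  Lipschitz l = ∀ {u v} → Adj 𝒢 u v → ∣ l u - l v ∣ ℕ.≤ 1

  Present-sym : ∀ l {u v} → Present 𝒢 l u v → Present 𝒢 l v u
  Present-sym l {u} {v} (uv , steep) = SimpleGraph.sym 𝒢 uv , trans (∣i-j∣≡∣j-i∣ (l v) (l u)) steep

  absent-or-oriented : ∀ l {u v} → Adj 𝒢 u v → l v - l u ≡ 0ℤ ⊎ l v - l u ≡ 1ℤ →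
    (¬ Present 𝒢 l u v) ⊎ Oriented 𝒢 l u v
  absent-or-oriented l _  (inj₁ flat) =
    inj₁ λ uv-present → let (_ , steep) = Present-sym l uv-present in
      0≢1+n (trans (≡-sym (cong ∣_∣ flat)) steep)
  absent-or-oriented l uv (inj₂ up) = inj₂ (uv , up)

  crossing-edge : ∀ l l′ {u v} → Lipschitz l → Lipschitz l′ → Adj 𝒢 u v →
    l′ v - l v < l′ u - l u →
    ((¬ Present 𝒢 l u v) ⊎ Oriented 𝒢 l u v) ×
    ((¬ Present 𝒢 l′ u v) ⊎ Oriented 𝒢 l′ v u)
  crossing-edge l l′ {u} {v} L L′ uv drop =
      absent-or-oriented l uv (∣i∣≤1∧∣j∣≤1∧0<i+j⇒i≡0⊎i≡1 _ _ (L vu) (L′ uv) jump)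
    , absent-present-sym
        (absent-or-oriented l′ vu (∣i∣≤1∧∣j∣≤1∧0<i+j⇒i≡0⊎i≡1 _ _ (L′ uv) (L vu) jump′))
    where
    vu : Adj 𝒢 v u
    vu = SimpleGraph.sym 𝒢 uv
    jump : 0ℤ < (l v - l u) + (l′ u - l′ v)
    jump = subst (0ℤ <_) (difference-jump (l u) (l′ u) (l v) (l′ v)) (i<j⇒0<j-i drop)
    jump′ : 0ℤ < (l′ u - l′ v) + (l v - l u)
    jump′ = subst (0ℤ <_) (+-comm (l v - l u) (l′ u - l′ v)) jump
    absent-present-sym : (¬ Present 𝒢 l′ v u) ⊎ Oriented 𝒢 l′ v u →
      (¬ Present 𝒢 l′ u v) ⊎ Oriented 𝒢 l′ v u
    absent-present-sym (inj₁ absent) = inj₁ (absent ∘ Present-sym l′)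
    absent-present-sym (inj₂ oriented) = inj₂ oriented

lemma3p11 : {n : ℕ} (𝒢 : SimpleGraph n) → Connected (Adj 𝒢) →
    (l l′ : Fin n → ℤ) → IsLayering 𝒢 l → IsLayering 𝒢 l′ →
    (x y : Fin n) → Oriented 𝒢 l x y → Oriented 𝒢 l′ y x →
    Σ (Fin n → Bool) λ side →
      (side x ≡ false) × (side y ≡ true) ×
      (∀ u v → Adj 𝒢 u v → side u ≡ false → side v ≡ true →
        ((¬ Present 𝒢 l u v) ⊎ Oriented 𝒢 l u v) ×
        ((¬ Present 𝒢 l′ u v) ⊎ Oriented 𝒢 l′ v u))
lemma3p11 𝒢 _ l l′ L L′ x y (_ , l-up) (_ , l′-down) = side , side-x , side-y , crossing
  where
  d : Fin _ → ℤ
  d w = l′ w - l w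

  side : Fin _ → Bool
  side w = does (d w <? d x)

  dy<dx : d y < d x
  dy<dx = 0<j-i⇒i<j (subst (0ℤ <_) (≡-sym jump) (+<+ (s≤s z≤n)))
    where
    jump : d x - d y ≡ + 2
    jump = trans (difference-jump (l x) (l′ x) (l y) (l′ y)) (cong₂ _+_ l-up l′-down)

  side-x : side x ≡ false
  side-x = dec-false (d x <? d x) (<-irrefl refl)

  side-y : side y ≡ true
  side-y = dec-true (d y <? d x) dy<dx

  crossing : ∀ u v → Adj 𝒢 u v → side u ≡ false → side v ≡ true →
    ((¬ Present 𝒢 l u v) ⊎ Oriented 𝒢 l u v) ×
    ((¬ Present 𝒢 l′ u v) ⊎ Oriented 𝒢 l′ v u)
  crossing u v uv su sv with d u <? d x | d v <? d x
  crossing u v uv () sv | yes _    | _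
  crossing u v uv su () | no _     | no _
  crossing u v uv su sv | no du≮dx | yes dv<dx =
    crossing-edge 𝒢 l l′ (lipschitz L) (lipschitz L′) uv (<-≤-trans dv<dx (≮⇒≥ du≮dx))
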